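{- Let $T$ be a finite tree and $c$ a coloring of $T$. Then $c\in\mathcal{P}_{\mathcal{MIN}}(T)$ (resp. $c\in\mathcal{P}_{\mathcal{MAJ}}(T)$) if and only if $|N^{c(u)}(u)|>|N^{1-c(u)}(u)|$ (resp. $|N^{c(u)}(u)|<|N^{1-c(u)}(u)|$) for every node $u$.
   Context: Colorings are maps $c:V\to\{0,1\}$; $N^i(v)$ is the set of neighbors of $v$ with color $i$. $\mathcal{MIN}(c)(v)=c(v)$ if $|N^{c(v)}(v)|\le|N^{1-c(v)}(v)|$, else $1-c(v)$; $\mathcal{MAJ}(c)(v)=c(v)$ if $|N^{c(v)}(v)|\ge|N^{1-c(v)}(v)|$, else $1-c(v)$. $\mathcal{P}_{\mathcal{M}}(T)$ is the set of pure 2-cycles: colorings $c$ with $\mathcal{M}(\mathcal{M}(c))=c$ and $\mathcal{M}(c)(v)\ne c(v)$ for every node $v$. -}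

module Defs where

open import Data.Nat using (ℕ; _≤_; _<_; _≤ᵇ_)
open import Data.Fin using (Fin)
open import Data.Bool using (Bool; true; false; not; if_then_else_; _∧_; _≟_)
open import Relation.Nullary.Decidable using (⌊_⌋)
open import Data.List using (List; []; _∷_; length; filterᵇ; allFin)
open import Data.List.Relation.Unary.Linked using (Linked)
open import Data.List.Relation.Unary.Unique.Propositional using (Unique)
open import Data.Product using (Σ; _×_)
open import Relation.Binary.PropositionalEquality using (_≡_; _≢_)
open import Relation.Nullary using (¬_)

record Graph (n : ℕ) : Set where
  field
    Adj    : Fin n → Fin n → Bool
    sym    : ∀ u v → Adj u v ≡ Adj v u
    irrefl : ∀ v → Adj v v ≡ false

open Graph public

module _ {n : ℕ} (G : Graph n) where

  Adjacent : Fin n → Fin n → Set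
  Adjacent u v = Adj G u v ≡ true

  data Walk : Fin n → Fin n → Set where
    here : ∀ {v} → Walk v v
    step : ∀ {u w v} → Adjacent u w → Walk w v → Walk u v

  Connected : Set
  Connected = ∀ u v → Walk u v

  lastOr : Fin n → List (Fin n) → Fin n
  lastOr x []       = x
  lastOr _ (y ∷ ys) = lastOr y ys

  IsCycle : Fin n → List (Fin n) → Set
  IsCycle x ys = (3 ≤ length (x ∷ ys)) × Unique (x ∷ ys)
               × Linked Adjacent (x ∷ ys) × Adjacent (lastOr x ys) x

  Acyclic : Set
  Acyclic = ∀ x ys → ¬ IsCycle x ys

  IsTree : Set
  IsTree = (1 ≤ n) × Connected × Acyclic

  Coloring : Set
  Coloring = Fin n → Bool

  N : Coloring → Bool → Fin n → List (Fin n)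
  N c i v = filterᵇ (λ u → Adj G v u ∧ ⌊ c u ≟ i ⌋) (allFin n)

  sameDeg : Coloring → Fin n → ℕ
  sameDeg c v = length (N c (c v) v)

  otherDeg : Coloring → Fin n → ℕ
  otherDeg c v = length (N c (not (c v)) v)

  MIN : Coloring → Coloring
  MIN c v = if sameDeg c v ≤ᵇ otherDeg c v then c v else not (c v)

  MAJ : Coloring → Coloring
  MAJ c v = if otherDeg c v ≤ᵇ sameDeg c v then c v else not (c v)

-- c ∈ P_M(T): M(M(c)) = c and every node changes colour under M
IsPure2Cycle : {n : ℕ} → ((Fin n → Bool) → (Fin n → Bool)) → (Fin n → Bool) → Set
IsPure2Cycle M c = (∀ v → M (M c) v ≡ c v) × (∀ v → M c v ≢ c v)

{-# OPTIONS --safe #-}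
module Submission where

-- A node changes colour exactly when its rule's "keep" test fails, and both
-- |N^{c(v)}(v)| and |N^{1-c(v)}(v)| are unchanged when every colour is flipped.
-- So if every node flips under M, the second step sees the same degree counts
-- and flips every node back; conversely a pure 2-cycle forces the keep test to
-- fail everywhere.

open import Defs hiding (sym)
open import Data.Nat using (ℕ; _<_; _≤ᵇ_)
open import Data.Nat.Properties using (≤ᵇ-reflects-≤; <⇒≱; ≰⇒>)
open import Data.Fin using (Fin)
open import Data.Bool using (Bool; true; false; not; if_then_else_; _∧_; _≟_; T)
open import Data.Bool.Properties using (not-involutive; not-¬)
open import Data.List using (List; length; filterᵇ; allFin)
open import Data.List.Properties using (filter-≐)
open import Data.Product using (_×_; _,_)
open import Function.Bundles using (_⇔_; mk⇔; Equivalence)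
open import Relation.Nullary using (contradiction)
open import Relation.Nullary.Decidable using (⌊_⌋)
open import Relation.Nullary.Reflects using (ofʸ; ofⁿ)
open import Relation.Binary.PropositionalEquality
  using (_≡_; _≢_; refl; sym; trans; cong; subst; module ≡-Reasoning)

filterᵇ-cong : ∀ {A : Set} {p q : A → Bool} → (∀ x → p x ≡ q x) →
               (xs : List A) → filterᵇ p xs ≡ filterᵇ q xs
filterᵇ-cong p≗q = filter-≐ _ _ ((λ {x} → subst T (p≗q x)) , (λ {x} → subst T (sym (p≗q x))))

⌊not≟not⌋ : ∀ x y → ⌊ not x ≟ not y ⌋ ≡ ⌊ x ≟ y ⌋
⌊not≟not⌋ false false = refl
⌊not≟not⌋ false true  = refl
⌊not≟not⌋ true  false = refl
⌊not≟not⌋ true  true  = refl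

≤ᵇ≡false⇔> : ∀ m k → (m ≤ᵇ k) ≡ false ⇔ k < m
≤ᵇ≡false⇔> m k with m ≤ᵇ k | ≤ᵇ-reflects-≤ m k
... | true  | ofʸ m≤k = mk⇔ (λ ()) (λ k<m → contradiction m≤k (<⇒≱ k<m))
... | false | ofⁿ m≰k = mk⇔ (λ _ → ≰⇒> m≰k) (λ _ → refl)

if-not≢⇒false : ∀ b x → (if b then x else not x) ≢ x → b ≡ false
if-not≢⇒false true  x moved = contradiction refl moved
if-not≢⇒false false x moved = refl

module _ {n : ℕ} (G : Graph n) where

  _IsComplementOf_ : Coloring G → Coloring G → Set
  c′ IsComplementOf c = ∀ v → c′ v ≡ not (c v)

  ComplementInvariant : {A : Set} → (Coloring G → Fin n → A) → Set
  ComplementInvariant f = ∀ {c c′} → c′ IsComplementOf c → ∀ v → f c′ v ≡ f c v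

  N-complement : ∀ {c c′} → c′ IsComplementOf c → ∀ i v → N G c′ (not i) v ≡ N G c i v
  N-complement {c} {c′} c′≗¬c i v = filterᵇ-cong sameTest (allFin n)
    where
    sameTest : ∀ u → (Adj G v u ∧ ⌊ c′ u ≟ not i ⌋) ≡ (Adj G v u ∧ ⌊ c u ≟ i ⌋)
    sameTest u = cong (Adj G v u ∧_)
      (trans (cong (λ x → ⌊ x ≟ not i ⌋) (c′≗¬c u)) (⌊not≟not⌋ (c u) i))

  sameDeg-complementInvariant : ComplementInvariant (sameDeg G)
  sameDeg-complementInvariant {c} {c′} c′≗¬c v = begin
    length (N G c′ (c′ v) v)        ≡⟨ cong (λ i → length (N G c′ i v)) (c′≗¬c v) ⟩
    length (N G c′ (not (c v)) v)   ≡⟨ cong length (N-complement c′≗¬c (c v) v) ⟩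
    length (N G c (c v) v)          ∎
    where open ≡-Reasoning

  otherDeg-complementInvariant : ComplementInvariant (otherDeg G)
  otherDeg-complementInvariant {c} {c′} c′≗¬c v = begin
    length (N G c′ (not (c′ v)) v)        ≡⟨ cong (λ i → length (N G c′ (not i) v)) (c′≗¬c v) ⟩
    length (N G c′ (not (not (c v))) v)   ≡⟨ cong length (N-complement c′≗¬c (not (c v)) v) ⟩
    length (N G c (not (c v)) v)          ∎
    where open ≡-Reasoning

  flipUnless : (Coloring G → Fin n → Bool) → Coloring G → Coloring G
  flipUnless keep c v = if keep c v then c v else not (c v)

  pure2Cycle⇔neverKeeps : (keep : Coloring G → Fin n → Bool) → ComplementInvariant keep →
    ∀ c → IsPure2Cycle (flipUnless keep) c ⇔ (∀ v → keep c v ≡ false)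
  pure2Cycle⇔neverKeeps keep invariant c = mk⇔ neverKeeps pure
    where
    neverKeeps : IsPure2Cycle (flipUnless keep) c → ∀ v → keep c v ≡ false
    neverKeeps (_ , moves) v = if-not≢⇒false (keep c v) (c v) (moves v)

    pure : (∀ v → keep c v ≡ false) → IsPure2Cycle (flipUnless keep) c
    pure never = returns , moves
      where
      flips : flipUnless keep c IsComplementOf c
      flips v = cong (λ b → if b then c v else not (c v)) (never v)

      returns : ∀ v → flipUnless keep (flipUnless keep c) v ≡ c v
      returns v = begin
        flipUnless keep (flipUnless keep c) v
          ≡⟨ cong (λ b → if b then flipUnless keep c v else not (flipUnless keep c v))
                  (trans (invariant flips v) (never v)) ⟩
        not (flipUnless keep c v)   ≡⟨ cong not (flips v) ⟩
        not (not (c v))             ≡⟨ not-involutive (c v) ⟩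
        c v                         ∎
        where open ≡-Reasoning

      moves : ∀ v → flipUnless keep c v ≢ c v
      moves v stays = not-¬ refl (trans (sym stays) (flips v))

  pure2Cycle⇔strict : (a b : Coloring G → Fin n → ℕ) →
    ComplementInvariant a → ComplementInvariant b →
    ∀ c → IsPure2Cycle (flipUnless (λ d v → a d v ≤ᵇ b d v)) c ⇔ (∀ v → b c v < a c v)
  pure2Cycle⇔strict a b a-inv b-inv c = mk⇔
    (λ pure v → Equivalence.to (≤ᵇ≡false⇔> (a c v) (b c v)) (Equivalence.to neverKeeps pure v))
    (λ strict → Equivalence.from neverKeeps
      (λ v → Equivalence.from (≤ᵇ≡false⇔> (a c v) (b c v)) (strict v)))
    where
    keepInvariant : ComplementInvariant (λ d v → a d v ≤ᵇ b d v)
    keepInvariant c′≗¬c v = trans (cong (_≤ᵇ b _ v) (a-inv c′≗¬c v))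
                                  (cong (a _ v ≤ᵇ_) (b-inv c′≗¬c v))

    neverKeeps : IsPure2Cycle (flipUnless (λ d v → a d v ≤ᵇ b d v)) c
               ⇔ (∀ v → (a c v ≤ᵇ b c v) ≡ false)
    neverKeeps = pure2Cycle⇔neverKeeps _ keepInvariant c

lemma12 : (n : ℕ) (T : Graph n) → IsTree T → (c : Fin n → Bool) →
    (IsPure2Cycle (MIN T) c ⇔ (∀ u → otherDeg T c u < sameDeg T c u))
    × (IsPure2Cycle (MAJ T) c ⇔ (∀ u → sameDeg T c u < otherDeg T c u))
lemma12 n G _ c =
    pure2Cycle⇔strict G (sameDeg G) (otherDeg G)
      (sameDeg-complementInvariant G) (otherDeg-complementInvariant G) c
  , pure2Cycle⇔strict G (otherDeg G) (sameDeg G)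
      (otherDeg-complementInvariant G) (sameDeg-complementInvariant G) c
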